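{- Let $n\ge 4$ be even and $f\ge 1$ an integer. Then \[ \overrightarrow{\beta}(K_n,f)\le \begin{cases} n-3f & \text{if } f<\frac{n-2}{4},\\ \frac{n}{2}-f+1 & \text{if } \frac{n-2}{4}\le f<\frac{n-2}{2},\\ 2 & \text{if } \frac{n-2}{2}\le f<\frac{n}{2},\\ 1 & \text{if } f\ge \frac{n}{2}, \end{cases} \] where $K_n$ is the complete graph on $n$ vertices.
   Context: Firefighting on oriented graphs: an orientation $\overrightarrow{G}$ of a finite simple graph $G$ replaces each edge $uv$ by exactly one of the arcs $\overrightarrow{uv}$, $\overrightarrow{vu}$. Let $f\ge 1$ be an integer. A fire breaks out at a vertex $v$ at time $1$ ($v$ burns). At the end of each time unit, the firefighters permanently protect up to $f$ vertices that are neither burning nor already protected. At the next time unit, every vertex that is neither burning nor protected and is an out-neighbour of a burning vertex starts to burn. The process ends when no new vertex can burn. $\beta(\overrightarrow{G},f)$ is the maximum, over all starting vertices $v$, of the minimum, over all protection strategies, of the number of vertices that burn. $\overrightarrow{\beta}(G,f)$ is the minimum of $\beta(\overrightarrow{G},f)$ over all orientations $\overrightarrow{G}$ of $G$. -}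

module Defs where

open import Data.Nat using (ℕ; zero; suc; _≤_)
open import Data.Bool using (Bool; true; false; _∧_; _∨_; not)
open import Data.Fin using (Fin; zero; suc)
open import Data.Fin.Subset using (Subset; ⁅_⁆; _∪_; _∈_; _∉_; ∣_∣) renaming (⊥ to ∅)
open import Data.Vec using (Vec; tabulate; lookup)
open import Data.Product using (Σ; _×_; _,_; proj₁; proj₂; ∃)
open import Data.Sum using (_⊎_)
open import Relation.Binary.PropositionalEquality using (_≡_; _≢_)
open import Relation.Nullary using (¬_)

record Graph (n : ℕ) : Set₁ where
  field
    Adj     : Fin n → Fin n → Set
    irrefl  : ∀ u → ¬ Adj u u
    sym     : ∀ u v → Adj u v → Adj v u

K : (n : ℕ) → Graph n
K n = record
  { Adj    = λ u v → u ≢ v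
  ; irrefl = λ u p → p _≡_.refl
  ; sym    = λ u v p q → p (Relation.Binary.PropositionalEquality.sym q)
  }
  where import Relation.Binary.PropositionalEquality

record Orientation {n : ℕ} (G : Graph n) : Set where
  field
    arc      : Fin n → Fin n → Bool
    arc⇒adj  : ∀ u v → arc u v ≡ true → Graph.Adj G u v
    adj⇒arc  : ∀ u v → Graph.Adj G u v → arc u v ≡ true ⊎ arc v u ≡ true
    antisym  : ∀ u v → arc u v ≡ true → arc v u ≡ false

anyFin : ∀ {n} → (Fin n → Bool) → Bool
anyFin {zero}  p = false
anyFin {suc n} p = p zero ∨ anyFin (λ i → p (suc i))

inside? : ∀ {n} → Fin n → Subset n → Bool
inside? i s with lookup s i
... | Data.Bool.true  = true
... | Data.Bool.false = false
  where import Data.Bool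

-- One spreading step: B is the burning set, P the protected set.
-- A vertex burns next if it already burns, or it is not protected and
-- is an out-neighbour of a burning vertex.
spread : ∀ {n} → (Fin n → Fin n → Bool) → Subset n → Subset n → Subset n
spread arc B P = tabulate λ w →
  inside? w B ∨ (not (inside? w P) ∧ anyFin (λ u → inside? u B ∧ arc u w))

-- A strategy: σ t is the set of vertices protected at the end of time
-- unit t+1 (time units start at 1).
Strategy : ℕ → Set
Strategy n = ℕ → Subset n

-- state t = (vertices burning at time t+1 ,
--            vertices protected before the end of time unit t+1)
state : ∀ {n} → (Fin n → Fin n → Bool) → Fin n → Strategy n → ℕ → Subset n × Subset n
state arc v σ zero    = ⁅ v ⁆ , ∅
state arc v σ (suc t) with state arc v σ t
... | B , P = spread arc B (P ∪ σ t) , P ∪ σ t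

burning : ∀ {n} → (Fin n → Fin n → Bool) → Fin n → Strategy n → ℕ → Subset n
burning arc v σ t = proj₁ (state arc v σ t)

Valid : ∀ {n} → (Fin n → Fin n → Bool) → ℕ → Fin n → Strategy n → Set
Valid arc f v σ = ∀ t →
  ∣ σ t ∣ ≤ f ×
  (∀ x → x ∈ σ t → x ∉ proj₁ (state arc v σ t) × x ∉ proj₂ (state arc v σ t))

ContainableWithin : ∀ {n} → (Fin n → Fin n → Bool) → ℕ → Fin n → ℕ → Set
ContainableWithin arc f v k =
  Σ (Strategy _) λ σ → Valid arc f v σ ×
    Σ ℕ λ t → burning arc v σ (suc t) ≡ burning arc v σ t ×
              ∣ burning arc v σ t ∣ ≤ k

βOr≤ : ∀ {n} {G : Graph n} → Orientation G → ℕ → ℕ → Set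
βOr≤ D f k = ∀ v → ContainableWithin (Orientation.arc D) f v k

β⃗≤ : ∀ {n} → Graph n → ℕ → ℕ → Set
β⃗≤ G f k = Σ (Orientation G) λ D → βOr≤ D f k

module Submission where

-- Upper bounds for β⃗(K_n, f), n = 2m, via one orientation T_m of K_n.
--
-- T_m has a sink receiving an arc from every other vertex; the remaining
-- k = 2m - 1 vertices form ℤ_k with i → j iff j is 1 to m - 1 steps
-- clockwise from i.  A fire at the sink never spreads.  A fire at a
-- vertex a is fought in three rounds: protect the f₀ vertices c, …, m - 1
-- steps clockwise from a (and possibly the sink), then the next g vertices,
-- then the last f₀; only the first c = 1 + g + r vertices, a further r
-- vertices and possibly the sink burn.  Choosing f₀, g, r in terms of f
-- gives the four regimes of the corollary.

open import Defs
open import Data.Nat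
  using (ℕ; zero; suc; _≤_; _<_; _+_; _*_; _∸_; z≤n; s≤s; s≤s⁻¹; _<?_; _≤?_; NonZero; >-nonZero⁻¹)
open import Data.Nat.Properties
open import Data.Nat.DivMod using (_%_; _mod_; m<n⇒m%n≡m; [m+n]%n≡m%n; m%n<n)
open import Data.Nat.Tactic.RingSolver using (solve-∀)
open import Data.Bool using (Bool; true; false; _∧_; _∨_; not)
import Data.Bool.Properties as Bool
open import Data.Fin using (Fin; zero; suc; toℕ)
open import Data.Fin.Properties using (any?; toℕ-injective; toℕ<n; toℕ-fromℕ<)
  renaming (suc-injective to fsuc-injective)
open import Data.Fin.Subset using (Subset; ⁅_⁆; _∪_; _∈_; _∉_; ∣_∣; _⊆_) renaming (⊥ to ∅)
open import Data.Fin.Subset.Properties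
  using (∉⊥; x∈p∪q⁻; x∈p∪q⁺; x∈⁅y⁆⇒x≡y; x∈⁅x⁆; ∣⁅x⁆∣≡1; ∣⊥∣≡0; ∣p∣≤n;
         p⊆q⇒∣p∣≤∣q∣; p⊂q⇒∣p∣<∣q∣; ⊆-antisym; _∈?_)
open import Data.Vec using ([]; _∷_; lookup)
open import Data.Vec.Properties using (lookup∘tabulate; []=⇒lookup; lookup⇒[]=; ≡-dec)
open import Data.List using (List; []; _∷_; [_]; length; applyUpTo; _++_)
open import Data.List.Properties using (length-++; length-applyUpTo)
open import Data.List.Membership.Propositional using () renaming (_∈_ to _∈ˡ_; _∉_ to _∉ˡ_)
open import Data.List.Membership.Propositional.Properties
  using (∈-applyUpTo⁺; ∈-applyUpTo⁻; ∈-++⁺ˡ; ∈-++⁺ʳ; ∈-++⁻)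
open import Data.List.Relation.Unary.Any using (here; there)
open import Data.Product using (_×_; _,_; proj₁; proj₂; ∃)
open import Data.Sum using (_⊎_; inj₁; inj₂)
open import Data.Unit using (⊤; tt)
open import Data.Empty using (⊥; ⊥-elim)
open import Relation.Nullary using (¬_; Dec; yes; no; does)
open import Relation.Nullary.Decidable using (_×-dec_; ¬?; dec-true; dec-false)
open import Relation.Binary.PropositionalEquality
  using (_≡_; _≢_; refl; sym; trans; cong; cong₂; subst; module ≡-Reasoning)

-- Subsets of Fin n given by a list of their elements.  The firefighters'
-- moves are built this way, and a list enumerating the burnt vertices
-- bounds their number.

∣p∪q∣≤∣p∣+∣q∣ : ∀ {n} (p q : Subset n) → ∣ p ∪ q ∣ ≤ ∣ p ∣ + ∣ q ∣
∣p∪q∣≤∣p∣+∣q∣ []          []          = z≤n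
∣p∪q∣≤∣p∣+∣q∣ (true ∷ p)  (true ∷ q)  =
  s≤s (≤-trans (∣p∪q∣≤∣p∣+∣q∣ p q) (≤-trans (n≤1+n _) (≤-reflexive (sym (+-suc ∣ p ∣ ∣ q ∣)))))
∣p∪q∣≤∣p∣+∣q∣ (true ∷ p)  (false ∷ q) = s≤s (∣p∪q∣≤∣p∣+∣q∣ p q)
∣p∪q∣≤∣p∣+∣q∣ (false ∷ p) (true ∷ q)  =
  ≤-trans (s≤s (∣p∪q∣≤∣p∣+∣q∣ p q)) (≤-reflexive (sym (+-suc ∣ p ∣ ∣ q ∣)))
∣p∪q∣≤∣p∣+∣q∣ (false ∷ p) (false ∷ q) = ∣p∪q∣≤∣p∣+∣q∣ p q

fromList : ∀ {n} → List (Fin n) → Subset n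
fromList []       = ∅
fromList (y ∷ ys) = ⁅ y ⁆ ∪ fromList ys

∣fromList∣≤length : ∀ {n} (ys : List (Fin n)) → ∣ fromList ys ∣ ≤ length ys
∣fromList∣≤length {n} [] = ≤-reflexive (∣⊥∣≡0 n)
∣fromList∣≤length (y ∷ ys) =
  ≤-trans (∣p∪q∣≤∣p∣+∣q∣ ⁅ y ⁆ (fromList ys))
          (+-mono-≤ (≤-reflexive (∣⁅x⁆∣≡1 y)) (∣fromList∣≤length ys))

fromList⁻ : ∀ {n} {x : Fin n} (ys : List (Fin n)) → x ∈ fromList ys → x ∈ˡ ys
fromList⁻ []       x∈ = ⊥-elim (∉⊥ x∈)
fromList⁻ (y ∷ ys) x∈ with x∈p∪q⁻ ⁅ y ⁆ (fromList ys) x∈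
... | inj₁ x∈y  = here (x∈⁅y⁆⇒x≡y y x∈y)
... | inj₂ x∈ys = there (fromList⁻ ys x∈ys)

fromList⁺ : ∀ {n} {x : Fin n} (ys : List (Fin n)) → x ∈ˡ ys → x ∈ fromList ys
fromList⁺ (y ∷ ys) (here refl) = x∈p∪q⁺ (inj₁ (x∈⁅x⁆ y))
fromList⁺ (y ∷ ys) (there x∈)  = x∈p∪q⁺ (inj₂ (fromList⁺ ys x∈))

∣_∣≤length : ∀ {n} {p : Subset n} (ys : List (Fin n)) → (∀ x → x ∈ p → x ∈ˡ ys) → ∣ p ∣ ≤ length ys
∣ ys ∣≤length p⊆ys = ≤-trans (p⊆q⇒∣p∣≤∣q∣ (λ {x} x∈p → fromList⁺ ys (p⊆ys x x∈p))) (∣fromList∣≤length ys)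

-- An increasing sequence of subsets of Fin n is eventually constant:
-- while it keeps growing, the i-th set has at least i elements, which
-- is impossible for i > n.
module _ {n : ℕ} (S : ℕ → Subset n) (increasing : ∀ i → S i ⊆ S (suc i)) where

  private
    newElement : (p q : Subset n) → p ⊆ q → p ≢ q → ∃ λ x → x ∈ q × x ∉ p
    newElement p q p⊆q p≢q with any? (λ x → (x ∈? q) ×-dec ¬? (x ∈? p))
    ... | yes new = new
    ... | no noNew = ⊥-elim (p≢q (⊆-antisym p⊆q q⊆p))
      where
        q⊆p : q ⊆ p
        q⊆p {x} x∈q with x ∈? p
        ... | yes x∈p = x∈p
        ... | no  x∉p = ⊥-elim (noNew (x , x∈q , x∉p))

    stableOrLarge : ∀ i → (∃ λ j → S (suc j) ≡ S j) ⊎ i ≤ ∣ S i ∣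
    stableOrLarge zero = inj₂ z≤n
    stableOrLarge (suc i) with stableOrLarge i
    ... | inj₁ stable = inj₁ stable
    ... | inj₂ large with ≡-dec Bool._≟_ (S (suc i)) (S i)
    ... | yes stable = inj₁ (i , stable)
    ... | no  grows  = inj₂ (<-≤-trans (s≤s large)
            (p⊂q⇒∣p∣<∣q∣ (increasing i , newElement _ _ (increasing i) (λ e → grows (sym e)))))

  eventuallyConstant : ∃ λ j → S (suc j) ≡ S j
  eventuallyConstant with stableOrLarge (suc n)
  ... | inj₁ stable = stable
  ... | inj₂ large  = ⊥-elim (n≮n n (<-≤-trans large (∣p∣≤n (S (suc n)))))

inside?-sound : ∀ {n} {x : Fin n} {s : Subset n} → inside? x s ≡ true → x ∈ s
inside?-sound {x = x} {s} eq with lookup s x in e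
... | true = lookup⇒[]= x s e

inside?-complete : ∀ {n} {x : Fin n} {s : Subset n} → x ∈ s → inside? x s ≡ true
inside?-complete {x = x} {s} x∈s with lookup s x | []=⇒lookup x∈s
... | true | _ = refl

anyFin-witness : ∀ {n} (p : Fin n → Bool) → anyFin p ≡ true → ∃ λ i → p i ≡ true
anyFin-witness {suc n} p eq with p zero in e
... | true  = zero , e
... | false with anyFin-witness (λ i → p (suc i)) eq
... | i , pi = suc i , pi

∧-true : ∀ {a b} → a ∧ b ≡ true → a ≡ true × b ≡ true
∧-true {true} {true} _ = refl , refl

module Process {n : ℕ} (arc : Fin n → Fin n → Bool) where

  spread-source : ∀ B P w → w ∈ spread arc B P →
                  w ∈ B ⊎ (w ∉ P × ∃ λ u → u ∈ B × arc u w ≡ true)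
  spread-source B P w w∈ with trans (sym (lookup∘tabulate _ w)) ([]=⇒lookup w∈)
  ... | burns with inside? w B in inB | inside? w P in inP
  ... | true  | _    = inj₁ (inside?-sound inB)
  ... | false | true = ⊥-elim (Bool.not-¬ refl burns)
  ... | false | false with anyFin-witness (λ u → inside? u B ∧ arc u w) burns
  ... | u , uw with ∧-true uw
  ... | u∈B , arc-uw =
    inj₂ ((λ w∈P → Bool.not-¬ refl (trans (sym (inside?-complete w∈P)) inP)) , u , inside?-sound u∈B , arc-uw)

  spread-keeps : ∀ B P → B ⊆ spread arc B P
  spread-keeps B P {w} w∈B = lookup⇒[]= w _ (trans (lookup∘tabulate _ w)
    (cong (λ b → b ∨ (not (inside? w P) ∧ anyFin (λ u → inside? u B ∧ arc u w))) (inside?-complete w∈B)))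

  no-move : ∀ f (B P : Subset n) → ∣ ∅ {n} ∣ ≤ f × (∀ x → x ∈ ∅ → x ∉ B × x ∉ P)
  no-move f B P = ≤-trans (≤-reflexive (∣⊥∣≡0 n)) z≤n , λ x x∈∅ → ⊥-elim (∉⊥ x∈∅)

  idle-valid : ∀ f v → Valid arc f v (λ _ → ∅)
  idle-valid f v t = no-move f _ _

  module Run (f : ℕ) (v : Fin n) (σ : Strategy n) where

    Burning Protected : ℕ → Subset n
    Burning t   = burning arc v σ t
    Protected t = proj₂ (state arc v σ t)

    burning-step : ∀ t w → w ∈ Burning (suc t) →
                   w ∈ Burning t ⊎ (w ∉ Protected t ∪ σ t × ∃ λ u → u ∈ Burning t × arc u w ≡ true)
    burning-step t w = spread-source (Burning t) (Protected t ∪ σ t) w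

    burning-mono : ∀ t → Burning t ⊆ Burning (suc t)
    burning-mono t = spread-keeps (Burning t) (Protected t ∪ σ t)

    protected-mono : ∀ s t → Protected t ⊆ Protected (s + t)
    protected-mono zero    t x∈ = x∈
    protected-mono (suc s) t x∈ = x∈p∪q⁺ (inj₁ (protected-mono s t x∈))

    burning-unprotected : Valid arc f v σ → ∀ t w → w ∈ Burning t → w ∉ Protected t
    burning-unprotected valid zero    w _ w∈P = ∉⊥ w∈P
    burning-unprotected valid (suc t) w w∈B w∈P with burning-step t w w∈B
    ... | inj₂ (w∉P , _) = w∉P w∈P
    ... | inj₁ w∈Bt with x∈p∪q⁻ (Protected t) (σ t) w∈P
    ... | inj₁ w∈Pt = burning-unprotected valid t w w∈Bt w∈Pt
    ... | inj₂ w∈σt = proj₁ (proj₂ (valid t) w w∈σt) w∈Bt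

    -- If from time s on all burning vertices lie in a list ys, the fire is
    -- contained with at most length ys burnt vertices: the burning sets
    -- increase, so they stabilise.
    containedWithin : Valid arc f v σ → (s : ℕ) (ys : List (Fin n)) →
                      (∀ t x → x ∈ Burning (t + s) → x ∈ˡ ys) →
                      ∀ {b} → length ys ≤ b → ContainableWithin arc f v b
    containedWithin valid s ys enumerates ys≤b
      with eventuallyConstant (λ t → Burning (t + s)) (λ t → burning-mono (t + s))
    ... | t , stable = σ , valid , t + s , stable , ≤-trans (∣ ys ∣≤length (enumerates t)) ys≤b

module Cyclic (k : ℕ) .{{_ : NonZero k}} where

  IsOffset : Fin k → Fin k → ℕ → Set
  IsOffset i j d = toℕ i + d ≡ toℕ j ⊎ toℕ i + d ≡ toℕ j + k

  offset : Fin k → Fin k → ℕ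
  offset i j with toℕ j <? toℕ i
  ... | yes _ = k + toℕ j ∸ toℕ i
  ... | no  _ = toℕ j ∸ toℕ i

  offset-spec : ∀ i j → IsOffset i j (offset i j) × offset i j < k
  offset-spec i j with toℕ j <? toℕ i
  ... | yes j<i = inj₂ wraps , +-cancelˡ-< (toℕ i) _ k (subst (_< toℕ i + k) (sym wraps) (+-monoˡ-< k j<i))
    where
      wraps : toℕ i + (k + toℕ j ∸ toℕ i) ≡ toℕ j + k
      wraps = trans (m+[n∸m]≡n (≤-trans (<⇒≤ (toℕ<n i)) (m≤m+n k (toℕ j)))) (+-comm k (toℕ j))
  ... | no  j≮i = inj₁ direct , +-cancelˡ-< (toℕ i) _ k (subst (_< toℕ i + k) (sym direct) (≤-trans (toℕ<n j) (m≤n+m k (toℕ i))))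
    where
      direct : toℕ i + (toℕ j ∸ toℕ i) ≡ toℕ j
      direct = m+[n∸m]≡n (≮⇒≥ j≮i)

  offset<k : ∀ i j → offset i j < k
  offset<k i j = proj₂ (offset-spec i j)

  -- Distances below k are unique, so every fact about offsets follows
  -- from exhibiting a distance with IsOffset.
  private
    wrapped-by-k : ∀ a b d d′ → a + d ≡ b → a + d′ ≡ b + k → d′ ≡ d + k
    wrapped-by-k a b d d′ direct wraps = +-cancelˡ-≡ a d′ (d + k) (begin
      a + d′     ≡⟨ wraps ⟩
      b + k      ≡⟨ cong (_+ k) (sym direct) ⟩
      a + d + k  ≡⟨ +-assoc a d k ⟩
      a + (d + k) ∎)
      where open ≡-Reasoning

    too-far : ∀ {d d′} → d′ < k → d′ ≡ d + k → ∀ {A : Set} → A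
    too-far {d} d′<k refl = ⊥-elim (<⇒≱ d′<k (m≤n+m k d))

  offset-unique : ∀ i j d → d < k → IsOffset i j d → d ≡ offset i j
  offset-unique i j d d<k isOff with offset-spec i j
  ... | isOff′ , d′<k with isOff | isOff′
  ... | inj₁ e | inj₁ e′ = +-cancelˡ-≡ (toℕ i) d _ (trans e (sym e′))
  ... | inj₂ e | inj₂ e′ = +-cancelˡ-≡ (toℕ i) d _ (trans e (sym e′))
  ... | inj₁ e | inj₂ e′ = too-far d′<k (wrapped-by-k _ _ d _ e e′)
  ... | inj₂ e | inj₁ e′ = too-far d<k (wrapped-by-k _ _ _ d e′ e)

  offset-self : ∀ i → offset i i ≡ 0
  offset-self i = sym (offset-unique i i 0 (>-nonZero⁻¹ k) (inj₁ (+-identityʳ (toℕ i))))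

  offset≡0⇒≡ : ∀ i j → offset i j ≡ 0 → i ≡ j
  offset≡0⇒≡ i j zero-offset with proj₁ (offset-spec i j)
  ... | inj₁ e = toℕ-injective (trans (sym (+-identityʳ (toℕ i))) (trans (cong (toℕ i +_) (sym zero-offset)) e))
  ... | inj₂ e = too-far (toℕ<n i) (trans (sym (trans (cong (toℕ i +_) zero-offset) (+-identityʳ (toℕ i)))) e)

  offset-turn : ∀ i j → i ≢ j → offset i j + offset j i ≡ k
  offset-turn i j i≢j = trans (cong (d +_) (sym (offset-unique j i (k ∸ d) back<k isBack))) (m+[n∸m]≡n (<⇒≤ d<k))
    where
      d = offset i j
      d<k = offset<k i j
      d≢0 : d ≢ 0
      d≢0 e = i≢j (offset≡0⇒≡ i j e)
      back<k : k ∸ d < k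
      back<k = ∸-monoʳ-< (n≢0⇒n>0 d≢0) (<⇒≤ d<k)
      isBack : IsOffset j i (k ∸ d)
      isBack with proj₁ (offset-spec i j)
      ... | inj₁ e = inj₂ (begin
              toℕ j + (k ∸ d)        ≡⟨ cong (_+ (k ∸ d)) (sym e) ⟩
              toℕ i + d + (k ∸ d)    ≡⟨ +-assoc (toℕ i) d (k ∸ d) ⟩
              toℕ i + (d + (k ∸ d))  ≡⟨ cong (toℕ i +_) (m+[n∸m]≡n (<⇒≤ d<k)) ⟩
              toℕ i + k              ∎)
        where open ≡-Reasoning
      ... | inj₂ e = inj₁ (+-cancelʳ-≡ d _ _ (begin
              toℕ j + (k ∸ d) + d    ≡⟨ +-assoc (toℕ j) (k ∸ d) d ⟩
              toℕ j + (k ∸ d + d)    ≡⟨ cong (toℕ j +_) (m∸n+n≡m (<⇒≤ d<k)) ⟩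
              toℕ j + k              ≡⟨ sym e ⟩
              toℕ i + d              ∎))
        where open ≡-Reasoning

  offset-trans : ∀ i j l → offset i j + offset j l < k → offset i l ≡ offset i j + offset j l
  offset-trans i j l short = sym (offset-unique i l (d + e) short isSum)
    where
      d = offset i j
      e = offset j l
      a = toℕ i
      assoc : a + (d + e) ≡ a + d + e
      assoc = sym (+-assoc a d e)
      swap : ∀ x y z → x + y + z ≡ x + z + y
      swap = solve-∀
      isSum : IsOffset i l (d + e)
      isSum with proj₁ (offset-spec i j) | proj₁ (offset-spec j l)
      ... | inj₁ e₁ | inj₁ e₂ = inj₁ (trans assoc (trans (cong (_+ e) e₁) e₂))
      ... | inj₁ e₁ | inj₂ e₂ = inj₂ (trans assoc (trans (cong (_+ e) e₁) e₂))
      ... | inj₂ e₁ | inj₁ e₂ = inj₂ (trans assoc (trans (cong (_+ e) e₁) (trans (swap (toℕ j) k e) (cong (_+ k) e₂))))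
      ... | inj₂ e₁ | inj₂ e₂ = ⊥-elim (<⇒≱ (+-mono-< (toℕ<n i) short) twoTurns)
        where
          twoTurns : k + k ≤ a + (d + e)
          twoTurns = begin
            k + k                 ≤⟨ m≤n+m (k + k) (toℕ l) ⟩
            toℕ l + (k + k)       ≡⟨ sym (+-assoc (toℕ l) k k) ⟩
            toℕ l + k + k         ≡⟨ cong (_+ k) (sym e₂) ⟩
            toℕ j + e + k         ≡⟨ swap (toℕ j) e k ⟩
            toℕ j + k + e         ≡⟨ cong (_+ e) (sym e₁) ⟩
            a + d + e             ≡⟨ sym assoc ⟩
            a + (d + e)           ∎
            where open ≤-Reasoning

  shift : Fin k → ℕ → Fin k
  shift i o = (toℕ i + o) mod k

  offset-shift : ∀ i o → o < k → offset i (shift i o) ≡ o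
  offset-shift i o o<k = sym (offset-unique i (shift i o) o o<k isOff)
    where
      a = toℕ i
      isOff : IsOffset i (shift i o) o
      isOff rewrite toℕ-fromℕ< (m%n<n (a + o) k) with a + o <? k
      ... | yes a+o<k = inj₁ (sym (m<n⇒m%n≡m a+o<k))
      ... | no  a+o≮k = inj₂ (begin
              a + o                  ≡⟨ sym (m∸n+n≡m k≤a+o) ⟩
              a + o ∸ k + k          ≡⟨ cong (_+ k) (sym (m<n⇒m%n≡m below)) ⟩
              (a + o ∸ k) % k + k    ≡⟨ cong (_+ k) (sym wrap) ⟩
              (a + o) % k + k        ∎)
        where
          open ≡-Reasoning
          k≤a+o = ≮⇒≥ a+o≮k
          wrap : (a + o) % k ≡ (a + o ∸ k) % k
          wrap = trans (cong (_% k) (sym (m∸n+n≡m k≤a+o))) ([m+n]%n≡m%n (a + o ∸ k) k)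
          below : a + o ∸ k < k
          below = +-cancelʳ-< k _ k (subst (_< k + k) (sym (m∸n+n≡m k≤a+o)) (+-mono-< (toℕ<n i) o<k))

  shift-offset : ∀ i j → shift i (offset i j) ≡ j
  shift-offset i j = toℕ-injective (trans (toℕ-fromℕ< (m%n<n _ k)) (reduce (proj₁ (offset-spec i j))))
    where
      reduce : IsOffset i j (offset i j) → (toℕ i + offset i j) % k ≡ toℕ j
      reduce (inj₁ e) = trans (cong (_% k) e) (m<n⇒m%n≡m (toℕ<n j))
      reduce (inj₂ e) = trans (cong (_% k) e) (trans ([m+n]%n≡m%n (toℕ j) k) (m<n⇒m%n≡m (toℕ<n j)))

-- The tournament T_m on N = 2m vertices: a sink (vertex zero) receiving an
-- arc from every other vertex, and on the remaining k = 2m - 1 vertices,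
-- seen as ℤ_k, the rotational tournament with i → j iff j lies between
-- 1 and m - 1 steps clockwise from i.
module Rotational (m′ : ℕ) where

  m k N : ℕ
  m = suc m′
  k = suc (m′ + m′)
  N = suc k

  open Cyclic k
  open Process

  Forward : ℕ → Set
  Forward d = 1 ≤ d × d < m

  forward? : ∀ d → Dec (Forward d)
  forward? d = (1 ≤? d) ×-dec (d <? m)

  private
    offset-pos : ∀ i j → i ≢ j → 1 ≤ offset i j
    offset-pos i j i≢j = n≢0⇒n>0 (λ e → i≢j (offset≡0⇒≡ i j e))

  -- Both directions cannot be forward: two forward offsets sum to at
  -- most 2m - 2 < k.
  forward-asym : ∀ i j → Forward (offset i j) → ¬ Forward (offset j i)
  forward-asym i j (1≤ij , ij<m) (_ , ji<m) =
    <⇒≱ (n<1+n (m′ + m′)) (subst (_≤ m′ + m′) (offset-turn i j i≢j) (+-mono-≤ (s≤s⁻¹ ij<m) (s≤s⁻¹ ji<m)))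
    where
      i≢j : i ≢ j
      i≢j refl = <⇒≱ 1≤ij (≤-reflexive (offset-self i))

  -- One direction is forward: the two offsets sum to k < 2m.
  forward-total : ∀ i j → i ≢ j → Forward (offset i j) ⊎ Forward (offset j i)
  forward-total i j i≢j with offset i j <? m
  ... | yes ij<m = inj₁ (offset-pos i j i≢j , ij<m)
  ... | no  ij≮m = inj₂ (offset-pos j i (λ e → i≢j (sym e)) , +-cancelˡ-< (offset i j) _ m
          (subst (_< offset i j + m) (sym (offset-turn i j i≢j))
                 (≤-trans (s≤s (≤-reflexive (sym (+-suc m′ m′)))) (+-monoˡ-≤ m (≮⇒≥ ij≮m)))))

  arc : Fin N → Fin N → Bool
  arc zero    _       = false
  arc (suc i) zero    = true
  arc (suc i) (suc j) = does (forward? (offset i j))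

  arc-forward : ∀ i j → arc (suc i) (suc j) ≡ true → Forward (offset i j)
  arc-forward i j = witness (forward? (offset i j))
    where
      witness : ∀ {P : Set} (P? : Dec P) → does P? ≡ true → P
      witness (yes p) _ = p

  orientation : Orientation (K N)
  orientation = record { arc = arc ; arc⇒adj = arc⇒adj ; adj⇒arc = adj⇒arc ; antisym = antisym }
    where
      arc⇒adj : ∀ u v → arc u v ≡ true → u ≢ v
      arc⇒adj (suc i) zero    _     ()
      arc⇒adj (suc i) (suc j) isArc e with fsuc-injective e
      ... | refl = <⇒≱ (proj₁ (arc-forward i i isArc)) (≤-reflexive (offset-self i))
      adj⇒arc : ∀ u v → u ≢ v → arc u v ≡ true ⊎ arc v u ≡ true
      adj⇒arc zero    zero    u≢v = ⊥-elim (u≢v refl)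
      adj⇒arc zero    (suc j) _   = inj₂ refl
      adj⇒arc (suc i) zero    _   = inj₁ refl
      adj⇒arc (suc i) (suc j) u≢v with forward-total i j (λ e → u≢v (cong suc e))
      ... | inj₁ fwd = inj₁ (dec-true (forward? (offset i j)) fwd)
      ... | inj₂ bwd = inj₂ (dec-true (forward? (offset j i)) bwd)
      antisym : ∀ u v → arc u v ≡ true → arc v u ≡ false
      antisym (suc i) zero    _     = refl
      antisym (suc i) (suc j) isArc = dec-false (forward? (offset j i)) (forward-asym i j (arc-forward i j isArc))

  sinkFire : ∀ f {b} → 1 ≤ b → ContainableWithin arc f zero b
  sinkFire f 1≤b = containedWithin idle 0 [ zero ] (λ t x x∈ → here (onlySink (t + 0) x x∈)) 1≤b
    where
      open Run arc f zero (λ _ → ∅)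
      idle = idle-valid arc f zero
      onlySink : ∀ t x → x ∈ Burning t → x ≡ zero
      onlySink zero    x x∈ = x∈⁅y⁆⇒x≡y zero x∈
      onlySink (suc t) x x∈ with burning-step t x x∈
      ... | inj₁ x∈Bt = onlySink t x x∈Bt
      ... | inj₂ (_ , u , u∈Bt , arc-ux) with onlySink t u u∈Bt
      onlySink (suc t) x x∈ | inj₂ (_ , u , u∈Bt , ()) | refl

  -- Where a vertex sits relative to the fire source suc a.  The sink
  -- counts as near (it may burn early) and never as far.
  Within Beyond : Fin k → ℕ → Fin N → Set
  Within a d zero    = ⊤
  Within a d (suc j) = offset a j < d
  Beyond a d zero    = ⊥
  Beyond a d (suc j) = d ≤ offset a j

  Between : Fin k → ℕ → ℕ → Fin N → Set
  Between a lo hi x = Beyond a lo x × Within a hi x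

  within-mono : ∀ a {d d′} x → d ≤ d′ → Within a d x → Within a d′ x
  within-mono a zero    _    _  = tt
  within-mono a (suc j) d≤d′ x< = <-≤-trans x< d≤d′

  apart : ∀ a d {σ S : Subset N} → (∀ {x} → x ∈ σ → Beyond a d x) → (∀ {x} → x ∈ S → Within a d x) →
          ∀ x → x ∈ σ → x ∉ S
  apart a d σ-far S-near (suc j) x∈σ x∈S = <⇒≱ (S-near x∈S) (σ-far x∈σ)
  apart a d σ-far S-near zero    x∈σ x∈S = σ-far x∈σ

  spread-within : ∀ a d B P → d + m′ ≤ k → (∀ {x} → x ∈ B → Within a d x) →
                  ∀ {w} → w ∈ spread arc B P → Within a (d + m′) w
  spread-within a d B P d+m′≤k B-near {w} w∈ with spread-source arc B P w w∈
  ... | inj₁ w∈B = within-mono a w (m≤m+n d m′) (B-near w∈B)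
  spread-within a d B P d+m′≤k B-near {zero}  w∈ | inj₂ _ = tt
  spread-within a d B P d+m′≤k B-near {suc j} w∈ | inj₂ (_ , suc i , i∈B , arc-ij) =
    subst (_< d + m′) (sym (offset-trans a i j (<-≤-trans walk d+m′≤k))) walk
    where
      walk : offset a i + offset i j < d + m′
      walk = +-mono-<-≤ (B-near i∈B) (s≤s⁻¹ (proj₂ (arc-forward i j arc-ij)))

  segment : Fin k → ℕ → ℕ → List (Fin N)
  segment a s l = applyUpTo (λ o → suc (shift a (s + o))) l

  segment⁻ : ∀ a s l {x} → s + l ≤ k → x ∈ˡ segment a s l → Between a s (s + l) x
  segment⁻ a s l s+l≤k x∈ with ∈-applyUpTo⁻ (λ o → suc (shift a (s + o))) x∈
  ... | o , o<l , refl rewrite offset-shift a (s + o) (<-≤-trans (+-monoʳ-< s o<l) s+l≤k) =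
    m≤m+n s o , +-monoʳ-< s o<l

  segment⁺ : ∀ a s l x → Between a s (s + l) x → x ∈ˡ segment a s l
  segment⁺ a s l (suc j) (s≤ , <s+l) =
    subst (_∈ˡ segment a s l) (cong suc onSegment) (∈-applyUpTo⁺ (λ o → suc (shift a (s + o))) o<l)
    where
      o = offset a j ∸ s
      s+o : s + o ≡ offset a j
      s+o = m+[n∸m]≡n s≤
      o<l : o < l
      o<l = +-cancelˡ-< s o l (subst (_< s + l) (sym s+o) <s+l)
      onSegment : shift a (s + o) ≡ j
      onSegment = trans (cong (shift a) s+o) (shift-offset a j)

  length-segment : ∀ a s l → length (segment a s l) ≡ l
  length-segment a s l = length-applyUpTo _ l

  sinkIf : Bool → List (Fin N)
  sinkIf true  = [ zero ]
  sinkIf false = []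

  sinkIf-sink : ∀ e {x} → x ∈ˡ sinkIf e → x ≡ zero
  sinkIf-sink true (here refl) = refl

  sink-unless : ∀ e → zero ∉ˡ sinkIf e → zero ∈ˡ sinkIf (not e)
  sink-unless true  unprotected = ⊥-elim (unprotected (here refl))
  sink-unless false _           = here refl

  m≤k : m ≤ k
  m≤k = s≤s (m≤m+n m′ m′)

  -- With c = 1 + g + r the cycle,
  -- read clockwise from a, is cut into segments of lengths
  --   c (burns at time 2), f₀ (protected at time 1), g (protected at time 2),
  --   r (burns at time 3), f₀ (protected at time 3);
  -- the sink is protected at time 1 when protectSink holds.  Round 1 stops
  -- the fire after the first segment, round 2 shields what the fire could
  -- still reach from there except for r vertices, and round 3 seals the rest.
  module ThreeRounds (f f₀ g r : ℕ) (protectSink : Bool) (split : g + r + f₀ ≡ m′)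
                     (budget₀ : f₀ + length (sinkIf protectSink) ≤ f) (budget₁ : g ≤ f)
                     (a : Fin k) where

    c : ℕ
    c = suc (g + r)

    c+f₀≡m : c + f₀ ≡ m
    c+f₀≡m = cong suc split

    turn : m + g + r + f₀ ≡ k
    turn = cong suc (trans (regroup m′ g r f₀) (cong (m′ +_) split))
      where
        regroup : ∀ x y z w → x + y + z + w ≡ x + (y + z + w)
        regroup = solve-∀

    reach : c + m′ ≡ m + g + r
    reach = shuffle g r m′
      where
        shuffle : ∀ g r m′ → suc (g + r) + m′ ≡ suc m′ + g + r
        shuffle = solve-∀

    m+g+r≤k : m + g + r ≤ k
    m+g+r≤k = subst (m + g + r ≤_) turn (m≤m+n (m + g + r) f₀)

    σ₀ σ₁ σ₂ : Subset N
    σ₀ = fromList (segment a c f₀ ++ sinkIf protectSink)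
    σ₁ = fromList (segment a m g)
    σ₂ = fromList (segment a (m + g + r) f₀)

    defence : Strategy N
    defence 0 = σ₀
    defence 1 = σ₁
    defence 2 = σ₂
    defence (suc (suc (suc _))) = ∅

    within-m⇒within-c+f₀ : ∀ x → Within a m x → Within a (c + f₀) x
    within-m⇒within-c+f₀ x = subst (λ h → Within a h x) (sym c+f₀≡m)

    σ₀-within : ∀ {x} → x ∈ σ₀ → Within a m x
    σ₀-within {x} x∈ with ∈-++⁻ (segment a c f₀) (fromList⁻ _ x∈)
    ... | inj₁ x∈seg = subst (λ h → Within a h x) c+f₀≡m
                         (proj₂ (segment⁻ a c f₀ (subst (_≤ k) (sym c+f₀≡m) m≤k) x∈seg))
    ... | inj₂ x∈sink with sinkIf-sink protectSink x∈sink
    ... | refl = tt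

    σ₀-spares-source : suc a ∉ σ₀
    σ₀-spares-source a∈ with ∈-++⁻ (segment a c f₀) (fromList⁻ _ a∈)
    ... | inj₁ a∈seg = <⇒≱ (s≤s z≤n) (subst (c ≤_) (offset-self a)
                         (proj₁ (segment⁻ a c f₀ (subst (_≤ k) (sym c+f₀≡m) m≤k) a∈seg)))
    ... | inj₂ a∈sink with sinkIf-sink protectSink a∈sink
    ... | ()

    σ₁-beyond : ∀ {x} → x ∈ σ₁ → Beyond a m x
    σ₁-beyond x∈ = proj₁ (segment⁻ a m g (≤-trans (m≤m+n (m + g) r) m+g+r≤k) (fromList⁻ _ x∈))

    σ₁-within : ∀ {x} → x ∈ σ₁ → Within a (m + g) x
    σ₁-within x∈ = proj₂ (segment⁻ a m g (≤-trans (m≤m+n (m + g) r) m+g+r≤k) (fromList⁻ _ x∈))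

    σ₂-beyond : ∀ {x} → x ∈ σ₂ → Beyond a (m + g + r) x
    σ₂-beyond x∈ = proj₁ (segment⁻ a (m + g + r) f₀ (≤-reflexive turn) (fromList⁻ _ x∈))

    open Run arc f (suc a) defence

    burning₀-within : ∀ {x} → x ∈ Burning 0 → Within a 1 x
    burning₀-within x∈ with x∈⁅y⁆⇒x≡y (suc a) x∈
    ... | refl = subst (_< 1) (sym (offset-self a)) (s≤s z≤n)

    -- Round 1 protects every out-neighbour of the source at least c steps
    -- away, so at time 2 only the first segment (and the sink) burns.
    burning₁-within : ∀ {x} → x ∈ Burning 1 → Within a c x
    burning₁-within {x} x∈ with burning-step 0 x x∈
    ... | inj₁ x∈B₀ = within-mono a x (s≤s z≤n) (burning₀-within x∈B₀)
    ... | inj₂ (x∉P , _) = nearOrProtected x (spread-within a 1 (Burning 0) (Protected 0 ∪ σ₀) m≤k burning₀-within x∈)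
                                             (λ x∈σ₀ → x∉P (x∈p∪q⁺ (inj₂ x∈σ₀)))
      where
        nearOrProtected : ∀ x → Within a m x → x ∉ σ₀ → Within a c x
        nearOrProtected zero    _    _     = tt
        nearOrProtected (suc j) j<m j∉σ₀ with offset a j <? c
        ... | yes j<c = j<c
        ... | no  j≮c = ⊥-elim (j∉σ₀ (fromList⁺ _ (∈-++⁺ˡ
                          (segment⁺ a c f₀ (suc j) (≮⇒≥ j≮c , within-m⇒within-c+f₀ (suc j) j<m)))))

    burning₂-within : ∀ {x} → x ∈ Burning 2 → Within a (m + g + r) x
    burning₂-within {x} x∈ = subst (λ h → Within a h x) reach
      (spread-within a c (Burning 1) (Protected 1 ∪ σ₁) (subst (_≤ k) (sym reach) m+g+r≤k) burning₁-within x∈)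

    protected₁-within : ∀ {x} → x ∈ Protected 1 → Within a m x
    protected₁-within x∈ with x∈p∪q⁻ ∅ σ₀ x∈
    ... | inj₁ x∈∅  = ⊥-elim (∉⊥ x∈∅)
    ... | inj₂ x∈σ₀ = σ₀-within x∈σ₀

    protected₂-within : ∀ {x} → x ∈ Protected 2 → Within a (m + g) x
    protected₂-within {x} x∈ with x∈p∪q⁻ (Protected 1) σ₁ x∈
    ... | inj₁ x∈P₁ = within-mono a x (m≤m+n m g) (protected₁-within x∈P₁)
    ... | inj₂ x∈σ₁ = σ₁-within x∈σ₁

    fits : ∀ (ys : List (Fin N)) {l} → length ys ≡ l → l ≤ f → ∣ fromList ys ∣ ≤ f
    fits ys len≡l l≤f = ≤-trans (∣fromList∣≤length ys) (subst (_≤ f) (sym len≡l) l≤f)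

    valid : Valid arc f (suc a) defence
    valid 0 = fits (segment a c f₀ ++ sinkIf protectSink)
                   (trans (length-++ (segment a c f₀) {sinkIf protectSink}) (cong (_+ _) (length-segment a c f₀))) budget₀
            , λ x x∈ → (λ x∈B → σ₀-spares-source (subst (_∈ σ₀) (x∈⁅y⁆⇒x≡y (suc a) x∈B) x∈)) , ∉⊥
    valid 1 = fits (segment a m g) (length-segment a m g) budget₁
            , λ x x∈ → apart a m σ₁-beyond (λ {y} y∈ → within-mono a y c≤m (burning₁-within y∈)) x x∈
                     , apart a m σ₁-beyond protected₁-within x x∈
      where
        c≤m : c ≤ m
        c≤m = subst (c ≤_) c+f₀≡m (m≤m+n c f₀)
    valid 2 = fits (segment a (m + g + r) f₀) (length-segment a (m + g + r) f₀) (≤-trans (m≤m+n f₀ _) budget₀)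
            , λ x x∈ → apart a (m + g + r) σ₂-beyond burning₂-within x x∈
                     , apart a (m + g + r) σ₂-beyond
                         (λ {y} y∈ → within-mono a y (m≤m+n (m + g) r) (protected₂-within y∈)) x x∈
    valid (suc (suc (suc t))) = no-move arc f _ _

    burnt : List (Fin N)
    burnt = sinkIf (not protectSink) ++ segment a 0 c ++ segment a (m + g) r

    length-burnt : length burnt ≡ length (sinkIf (not protectSink)) + (c + r)
    length-burnt = begin
      length burnt
        ≡⟨ length-++ (sinkIf (not protectSink)) ⟩
      length (sinkIf (not protectSink)) + length (segment a 0 c ++ segment a (m + g) r)
        ≡⟨ cong (length (sinkIf (not protectSink)) +_) (length-++ (segment a 0 c)) ⟩
      length (sinkIf (not protectSink)) + (length (segment a 0 c) + length (segment a (m + g) r))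
        ≡⟨ cong (λ l → length (sinkIf (not protectSink)) + l)
                (cong₂ _+_ (length-segment a 0 c) (length-segment a (m + g) r)) ⟩
      length (sinkIf (not protectSink)) + (c + r) ∎
      where open ≡-Reasoning

    unprotected-burnt : ∀ x → x ∉ σ₀ → x ∉ σ₁ → x ∉ σ₂ → x ∈ˡ burnt
    unprotected-burnt zero ∉σ₀ _ _ =
      ∈-++⁺ˡ (sink-unless protectSink (λ z∈ → ∉σ₀ (fromList⁺ _ (∈-++⁺ʳ (segment a c f₀) z∈))))
    unprotected-burnt (suc j) ∉σ₀ ∉σ₁ ∉σ₂
      with offset a j <? c | offset a j <? m | offset a j <? m + g | offset a j <? m + g + r
    ... | yes j<c | _       | _         | _ =
      ∈-++⁺ʳ (sinkIf (not protectSink)) (∈-++⁺ˡ (segment⁺ a 0 c (suc j) (z≤n , j<c)))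
    ... | no  j≮c | yes j<m | _         | _ = ⊥-elim (∉σ₀ (fromList⁺ _ (∈-++⁺ˡ
      (segment⁺ a c f₀ (suc j) (≮⇒≥ j≮c , within-m⇒within-c+f₀ (suc j) j<m)))))
    ... | no  _   | no  j≮m | yes j<m+g | _ =
      ⊥-elim (∉σ₁ (fromList⁺ _ (segment⁺ a m g (suc j) (≮⇒≥ j≮m , j<m+g))))
    ... | no  _   | no  _   | no  j≮m+g | yes j<m+g+r =
      ∈-++⁺ʳ (sinkIf (not protectSink)) (∈-++⁺ʳ (segment a 0 c)
        (segment⁺ a (m + g) r (suc j) (≮⇒≥ j≮m+g , j<m+g+r)))
    ... | no  _   | no  _   | no  _     | no  j≮m+g+r = ⊥-elim (∉σ₂ (fromList⁺ _
      (segment⁺ a (m + g + r) f₀ (suc j) (≮⇒≥ j≮m+g+r , subst (offset a j <_) (sym turn) (offset<k a j)))))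

    -- From time 3 on every burning vertex is unprotected, hence on the burnt list.
    contained : ∀ {b} → length (sinkIf (not protectSink)) + (c + r) ≤ b → ContainableWithin arc f (suc a) b
    contained {b} bound = containedWithin valid 3 burnt enumerates (subst (_≤ b) (sym length-burnt) bound)
      where
        enumerates : ∀ t x → x ∈ Burning (t + 3) → x ∈ˡ burnt
        enumerates t x x∈ = unprotected-burnt x
          (λ x∈σ₀ → unprotected (x∈p∪q⁺ (inj₁ (x∈p∪q⁺ (inj₁ (x∈p∪q⁺ (inj₂ x∈σ₀)))))))
          (λ x∈σ₁ → unprotected (x∈p∪q⁺ (inj₁ (x∈p∪q⁺ (inj₂ x∈σ₁)))))
          (λ x∈σ₂ → unprotected (x∈p∪q⁺ (inj₂ x∈σ₂)))
          where
            unprotected : x ∉ Protected 3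
            unprotected x∈P = burning-unprotected valid (t + 3) x x∈ (protected-mono t 3 x∈P)

  rotationalBound : ∀ f f₀ g r (protectSink : Bool) {b} → g + r + f₀ ≡ m′ →
                    f₀ + length (sinkIf protectSink) ≤ f → g ≤ f →
                    length (sinkIf (not protectSink)) + (suc (g + r) + r) ≤ b → β⃗≤ (K N) f b
  rotationalBound f f₀ g r protectSink split budget₀ budget₁ bound = orientation , λ
    { zero    → sinkFire f (≤-trans (s≤s z≤n) (≤-trans (m≤n+m _ _) bound))
    ; (suc a) → ThreeRounds.contained f f₀ g r protectSink split budget₀ budget₁ a bound }

open Rotational using (rotationalBound)

onK : ∀ m′ {f b} → β⃗≤ (K (Rotational.N m′)) f b → β⃗≤ (K (2 * suc m′)) f b
onK m′ {f} {b} = subst (λ n → β⃗≤ (K n) f b) (doubling m′)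
  where
    doubling : ∀ m′ → suc (suc (m′ + m′)) ≡ 2 * suc m′
    doubling = solve-∀

-- Few firefighters (2f ≤ m - 1): f₀ = g = f and r = m - 1 - 2f, so
-- 1 + (1 + f + r) + r = 2m - 3f vertices burn.
sparse : ∀ m′ f → f + f ≤ m′ → β⃗≤ (K (2 * suc m′)) f (2 * suc m′ ∸ 3 * f)
sparse m′ f 2f≤m′ with m≤n⇒∃[o]m+o≡n 2f≤m′
... | r , refl = onK (f + f + r)
  (rotationalBound (f + f + r) f f f r false (split f r) (≤-reflexive (+-identityʳ f)) ≤-refl bound)
  where
    split : ∀ f r → f + r + f ≡ f + f + r
    split = solve-∀
    count : ∀ f r → 2 * suc (f + f + r) ≡ 3 * f + (1 + (suc (f + r) + r))
    count = solve-∀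
    bound : 1 + (suc (f + r) + r) ≤ 2 * suc (f + f + r) ∸ 3 * f
    bound = ≤-reflexive (sym (trans (cong (_∸ 3 * f) (count f r)) (m+n∸m≡n (3 * f) _)))

-- Moderately many (f ≤ m - 1 ≤ 2f): f₀ = f, g = m - 1 - f ≤ f and r = 0,
-- so m - f + 1 vertices burn.
moderate : ∀ m′ f → f ≤ m′ → m′ ≤ f + f → β⃗≤ (K (2 * suc m′)) f (suc m′ ∸ f + 1)
moderate m′ f f≤m′ m′≤2f with m≤n⇒∃[o]m+o≡n f≤m′
... | g , refl = onK (f + g)
  (rotationalBound (f + g) f f g 0 false (split f g) (≤-reflexive (+-identityʳ f)) (+-cancelˡ-≤ f g f m′≤2f) bound)
  where
    split : ∀ f g → g + 0 + f ≡ f + g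
    split = solve-∀
    count : ∀ g → 1 + (suc (g + 0) + 0) ≡ suc g + 1
    count = solve-∀
    bound : 1 + (suc (g + 0) + 0) ≤ suc (f + g) ∸ f + 1
    bound = ≤-reflexive (trans (count g) (cong (_+ 1) (sym (trans (cong (_∸ f) (sym (+-suc f g))) (m+n∸m≡n f (suc g))))))

-- Many (m ≤ f): round 1 protects the sink and every out-neighbour of the
-- source, so only the source burns.
dense : ∀ m′ f → suc m′ ≤ f → β⃗≤ (K (2 * suc m′)) f 1
dense m′ f m≤f = onK m′ (rotationalBound m′ f m′ 0 0 true refl (subst (_≤ f) (+-comm 1 m′) m≤f) z≤n ≤-refl)

-- One fewer than m (f = m - 1): the moderate defence burns exactly two vertices.
oneShort : ∀ m′ f → m′ ≤ f → f ≤ m′ → β⃗≤ (K (2 * suc m′)) f 2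
oneShort m′ f m′≤f f≤m′ with ≤-antisym m′≤f f≤m′
... | refl = subst (β⃗≤ (K (2 * suc f)) f) (cong (_+ 1) (m+n∸n≡m 1 f)) (moderate f f ≤-refl (m≤m+n f f))

module Halving (m′ f : ℕ) where

  private
    n = 2 * suc m′
    halve< : ∀ {x y} → 2 * x < 2 * y → x < y
    halve< = *-cancelˡ-< 2 _ _
    halve : ∀ {x y} → 2 * x ≤ 2 * y → x ≤ y
    halve = *-cancelˡ-≤ 2
    4f+2≡2[1+2f] : 4 * f + 2 ≡ 2 * suc (f + f)
    4f+2≡2[1+2f] = lemma f
      where lemma : ∀ f → 4 * f + 2 ≡ 2 * suc (f + f)
            lemma = solve-∀
    2f+2≡2[1+f] : 2 * f + 2 ≡ 2 * suc f
    2f+2≡2[1+f] = lemma f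
      where lemma : ∀ f → 2 * f + 2 ≡ 2 * suc f
            lemma = solve-∀

  above-4f+2 : 4 * f + 2 < n → f + f ≤ m′
  above-4f+2 h = <⇒≤ (s≤s⁻¹ (halve< (subst (_< n) 4f+2≡2[1+2f] h)))

  below-4f+2 : n ≤ 4 * f + 2 → m′ ≤ f + f
  below-4f+2 h = s≤s⁻¹ (halve (subst (n ≤_) 4f+2≡2[1+2f] h))

  above-2f+2 : 2 * f + 2 < n → f ≤ m′
  above-2f+2 h = <⇒≤ (s≤s⁻¹ (halve< (subst (_< n) 2f+2≡2[1+f] h)))

  below-2f+2 : n ≤ 2 * f + 2 → m′ ≤ f
  below-2f+2 h = s≤s⁻¹ (halve (subst (n ≤_) 2f+2≡2[1+f] h))

  above-2f : 2 * f < n → f ≤ m′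
  above-2f h = s≤s⁻¹ (halve< h)

  below-2f : n ≤ 2 * f → suc m′ ≤ f
  below-2f = halve

corollary3p4 : (n m f : ℕ) → n ≡ 2 * m → 4 ≤ n → 1 ≤ f →
    (4 * f + 2 < n → β⃗≤ (K n) f (n ∸ 3 * f)) ×
    (n ≤ 4 * f + 2 → 2 * f + 2 < n → β⃗≤ (K n) f (m ∸ f + 1)) ×
    (n ≤ 2 * f + 2 → 2 * f < n → β⃗≤ (K n) f 2) ×
    (n ≤ 2 * f → β⃗≤ (K n) f 1)
corollary3p4 .(2 * zero) zero f refl () _
corollary3p4 .(2 * suc m′) (suc m′) f refl _ _ =
    (λ few → sparse m′ f (above-4f+2 few))
  , (λ notFew notMany → moderate m′ f (above-2f+2 notMany) (below-4f+2 notFew))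
  , (λ notMany many → oneShort m′ f (below-2f+2 notMany) (above-2f many))
  , (λ many → dense m′ f (below-2f many))
  where open Halving m′ f
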